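{- Let $v,k,m,\lambda,t,n$ be positive integers with $t>2$ and $n \le k-t+1$. Let $(X,\mathcal{B})$ be a $t$-$(v,k,m,\lambda)$ general covering design, and let $S$ be a set with $|S|=n$ and $X\cap S=\emptyset$. For every $x\in X$ put $\mathcal{B}(x)=\{B\setminus\{x\} : B\in\mathcal{B},\ x\in B\}$ (as a multiset), and choose $a\in X$ such that $|\mathcal{B}(a)|\le|\mathcal{B}(x)|$ for all $x\in X$. Let $(X\setminus\{a\},\mathcal{C})$ be a $(t-2)$-$(v-1,k-n-1,m-2,\lambda)$ general covering design. Define $\mathcal{B}_1=\mathcal{B}$, $\mathcal{B}_2=\{B\cup\{s\} : B\in\mathcal{B}(a),\ s\in S\}$, $\mathcal{B}_3=\{C\cup S\cup\{a\} : C\in\mathcal{C}\}$. Then $(X\cup S,\ \mathcal{B}_1\cup\mathcal{B}_2\cup\mathcal{B}_3)$ is a $t$-$(v+n,k,m,\lambda)$ general covering design.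
   Context: For positive integers $v,k,m,\lambda,t$ with $v\ge k\ge t$ and $v\ge m\ge t$, a $t$-$(v,k,m,\lambda)$ general covering design is a pair $(X,\mathcal{B})$ where $X$ is a set of $v$ points and $\mathcal{B}$ is a multiset of $k$-subsets of $X$ (blocks) such that every $m$-subset of $X$ intersects at least $\lambda$ members of $\mathcal{B}$ in at least $t$ points. Unions of multisets of blocks are taken so that a block appearing $r_1$ times in one collection and $r_2$ times in another appears $\max\{r_1,r_2\}$ times in the union. -}

module Defs where

open import Data.Nat using (ℕ; _≤_; _≤?_)
open import Data.Bool using (Bool)
open import Data.Bool.Properties using () renaming (_≟_ to _≟ᵇ_)
open import Data.Fin using (Fin)
open import Data.Fin.Subset using (Subset; _∈_; _⊆_; _∩_; _∪_; _-_; ⁅_⁆; ∣_∣)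
open import Data.Fin.Subset.Properties using (_∈?_)
open import Data.List using (List; []; _∷_; _++_; length; filter; map; concatMap; allFin)
open import Data.List.Relation.Unary.All using (All)
open import Data.Product using (_×_)
open import Data.Vec.Properties using (≡-dec)
open import Relation.Binary.PropositionalEquality using (_≡_)
open import Relation.Nullary using (yes; no)

-- Point sets are subsets of an ambient finite type Fin N; blocks are
-- subsets of Fin N; a multiset of blocks is a list (multiplicity =
-- number of occurrences).

private variable N : ℕ

removeOne : Subset N → List (Subset N) → List (Subset N)
removeOne x [] = []
removeOne x (y ∷ ys) with ≡-dec _≟ᵇ_ x y
... | yes _ = ys
... | no  _ = y ∷ removeOne x ys

_∖ₘ_ : List (Subset N) → List (Subset N) → List (Subset N)
ys ∖ₘ [] = ys
ys ∖ₘ (x ∷ xs) = removeOne x ys ∖ₘ xs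

-- multiset union with max multiplicities
infixl 6 _∪ₘ_
_∪ₘ_ : List (Subset N) → List (Subset N) → List (Subset N)
A ∪ₘ B = A ++ (B ∖ₘ A)

hits : ℕ → Subset N → List (Subset N) → ℕ
hits t M ℬ = length (filter (λ B → t ≤? ∣ M ∩ B ∣) ℬ)

IsGCD : ∀ {N} → Subset N → (v k m lam t : ℕ) → List (Subset N) → Set
IsGCD {N} X v k m lam t ℬ =
  ∣ X ∣ ≡ v × 1 ≤ t × t ≤ k × k ≤ v × t ≤ m × m ≤ v × 1 ≤ lam ×
  All (λ B → B ⊆ X × ∣ B ∣ ≡ k) ℬ ×
  (∀ (M : Subset N) → M ⊆ X → ∣ M ∣ ≡ m → lam ≤ hits t M ℬ)

elems : ∀ {N} → Subset N → List (Fin N)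
elems {N} S = filter (_∈? S) (allFin N)

derived : Fin N → List (Subset N) → List (Subset N)
derived x ℬ = map (λ B → B - x) (filter (λ B → x ∈? B) ℬ)

blocks₂ : Subset N → Fin N → List (Subset N) → List (Subset N)
blocks₂ S a ℬ = concatMap (λ B → map (λ s → B ∪ ⁅ s ⁆) (elems S)) (derived a ℬ)

blocks₃ : Subset N → Fin N → List (Subset N) → List (Subset N)
blocks₃ S a 𝒞 = map (λ C → C ∪ S ∪ ⁅ a ⁆) 𝒞

module Submission where

-- Put T = S ∪ {a}; then X ∪ S is the disjoint union of X - a and T, and the
-- third family of blocks is ℬ₃ = { C ∪ T : C ∈ 𝒞 }.  Every block of ℬ, ℬ₂ and
-- ℬ₃ is a k-subset of X ∪ S (for ℬ₃ this uses n + 1 ≤ k, a consequence of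
-- t > 2 and n ≤ k - t + 1).  For the covering property let M ⊆ X ∪ S, |M| = m.
--   * If M misses S, then M ⊆ X is met λ times by ℬ.
--   * If |M ∩ T| ≥ 2, complete M ∩ (X - a) to an (m-2)-subset R of X - a; each
--     block C of 𝒞 meeting R in t-2 points lifts to C ∪ T meeting M in t
--     points (`lift-cover`).
--   * Otherwise M ∩ T = {s} with s ∈ S, so a ∉ M.  The set M' = (M - s) ∪ {a}
--     lies in X and is met λ times by ℬ; a block B meeting M' in t points meets
--     M in t points, or else a ∈ B and (B - a) ∪ {s} ∈ ℬ₂ does (`swap-hits`).
--     As ℬ₂-blocks contain points of S, ℬ ∪ₘ ℬ₂ is just ℬ ++ ℬ₂.

open import Defs
open import Data.Bool using (true; false)
open import Data.Bool.Properties using () renaming (_≟_ to _≟ᵇ_)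
open import Data.Empty using (⊥-elim)
open import Data.Fin using (Fin)
open import Data.Fin.Properties using () renaming (_≟_ to _≟ᶠ_)
open import Data.Fin.Subset
open import Data.Fin.Subset.Properties
open import Data.List using (List; []; _∷_; _++_; length; filter; map; concatMap; allFin)
open import Data.List.Membership.Propositional using () renaming (_∈_ to _∈ₗ_)
open import Data.List.Membership.Propositional.Properties using (∈-map⁺; ∈-filter⁺; ∈-allFin)
open import Data.List.Properties using (filter-++; filter-accept; filter-reject; length-++)
open import Data.List.Relation.Unary.All as All using (All; []; _∷_)
open import Data.List.Relation.Unary.All.Properties using (++⁺; all-filter; map⁺)
open import Data.List.Relation.Unary.Any using (here; there)
open import Data.Nat using (ℕ; zero; suc; _≤_; _<_; _+_; _∸_; z≤n; s≤s; _≤?_)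
open import Data.Nat.Properties
open import Algebra.Properties.CommutativeSemigroup +-commutativeSemigroup using (x∙yz≈y∙xz)
open import Data.Product using (Σ-syntax; _×_; _,_; proj₁; proj₂)
open import Data.Sum using (inj₁; inj₂; [_,_]′)
open import Data.Vec using ([]; _∷_)
open import Data.Vec.Base using () renaming (here to at-head; there to in-tail)
open import Data.Vec.Properties using (≡-dec)
open import Function using (_∘_)
open import Relation.Binary.PropositionalEquality
open import Relation.Nullary using (¬_; yes; no; contradiction)

private variable
  N : ℕ

Empty-∩⁺ : {p q : Subset N} → (∀ {x} → x ∈ p → x ∉ q) → Empty (p ∩ q)
Empty-∩⁺ {p = p} {q} excl (x , x∈p∩q) = excl (proj₁ (x∈p∩q⁻ p q x∈p∩q)) (proj₂ (x∈p∩q⁻ p q x∈p∩q))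

Empty-∩⁻ : {p q : Subset N} → Empty (p ∩ q) → ∀ {x} → x ∈ p → x ∉ q
Empty-∩⁻ p∩q=∅ {x} x∈p x∈q = p∩q=∅ (x , x∈p∩q⁺ (x∈p , x∈q))

∪-⊆ : {p q r : Subset N} → p ⊆ r → q ⊆ r → p ∪ q ⊆ r
∪-⊆ {p = p} {q} p⊆r q⊆r x∈p∪q = [ p⊆r , q⊆r ]′ (x∈p∪q⁻ p q x∈p∪q)

∩-monoʳ-⊆ : (p : Subset N) {q r : Subset N} → q ⊆ r → p ∩ q ⊆ p ∩ r
∩-monoʳ-⊆ p {q} q⊆r x∈p∩q = x∈p∩q⁺ (proj₁ (x∈p∩q⁻ p q x∈p∩q) , q⊆r (proj₂ (x∈p∩q⁻ p q x∈p∩q)))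

⁅x⁆⊆ : {p : Subset N} {x : Fin N} → x ∈ p → ⁅ x ⁆ ⊆ p
⁅x⁆⊆ {p = p} {x} x∈p y∈⁅x⁆ = subst (_∈ p) (sym (x∈⁅y⁆⇒x≡y x y∈⁅x⁆)) x∈p

⊆-∪-avoid : {p q r : Subset N} → p ⊆ q ∪ r → Empty (p ∩ r) → p ⊆ q
⊆-∪-avoid {q = q} {r} p⊆q∪r p∩r=∅ x∈p =
  [ (λ x∈q → x∈q) , (λ x∈r → contradiction x∈r (Empty-∩⁻ p∩r=∅ x∈p)) ]′ (x∈p∪q⁻ q r (p⊆q∪r x∈p))

x∈p─q⇒x∉q : (p q : Subset N) {x : Fin N} → x ∈ p ─ q → x ∉ q
x∈p─q⇒x∉q (_ ∷ p) (true ∷ q)  (in-tail x∈p─q) (in-tail x∈q) = x∈p─q⇒x∉q p q x∈p─q x∈q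
x∈p─q⇒x∉q (_ ∷ p) (false ∷ q) (in-tail x∈p─q) (in-tail x∈q) = x∈p─q⇒x∉q p q x∈p─q x∈q
x∈p─q⇒x∉q (true ∷ p) (false ∷ q) at-head ()

x∈p-y⇒x≢y : (p : Subset N) {x y : Fin N} → x ∈ p - y → x ≢ y
x∈p-y⇒x≢y p {y = y} x∈p-y refl = x∈p─q⇒x∉q p ⁅ y ⁆ x∈p-y (x∈⁅x⁆ y)

∣p∪q∣+∣p∩q∣≡∣p∣+∣q∣ : (p q : Subset N) → ∣ p ∪ q ∣ + ∣ p ∩ q ∣ ≡ ∣ p ∣ + ∣ q ∣
∣p∪q∣+∣p∩q∣≡∣p∣+∣q∣ []          []          = refl
∣p∪q∣+∣p∩q∣≡∣p∣+∣q∣ (true ∷ p)  (true ∷ q)  = cong suc (begin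
  ∣ p ∪ q ∣ + suc ∣ p ∩ q ∣    ≡⟨ +-suc ∣ p ∪ q ∣ ∣ p ∩ q ∣ ⟩
  suc (∣ p ∪ q ∣ + ∣ p ∩ q ∣)  ≡⟨ cong suc (∣p∪q∣+∣p∩q∣≡∣p∣+∣q∣ p q) ⟩
  suc (∣ p ∣ + ∣ q ∣)          ≡⟨ +-suc ∣ p ∣ ∣ q ∣ ⟨
  ∣ p ∣ + suc ∣ q ∣            ∎)
  where open ≡-Reasoning
∣p∪q∣+∣p∩q∣≡∣p∣+∣q∣ (true ∷ p)  (false ∷ q) = cong suc (∣p∪q∣+∣p∩q∣≡∣p∣+∣q∣ p q)
∣p∪q∣+∣p∩q∣≡∣p∣+∣q∣ (false ∷ p) (true ∷ q)  =
  trans (cong suc (∣p∪q∣+∣p∩q∣≡∣p∣+∣q∣ p q)) (sym (+-suc ∣ p ∣ ∣ q ∣))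
∣p∪q∣+∣p∩q∣≡∣p∣+∣q∣ (false ∷ p) (false ∷ q) = ∣p∪q∣+∣p∩q∣≡∣p∣+∣q∣ p q

∣p∪q∣≤∣p∣+∣q∣ : (p q : Subset N) → ∣ p ∪ q ∣ ≤ ∣ p ∣ + ∣ q ∣
∣p∪q∣≤∣p∣+∣q∣ p q = ≤-trans (m≤m+n ∣ p ∪ q ∣ ∣ p ∩ q ∣) (≤-reflexive (∣p∪q∣+∣p∩q∣≡∣p∣+∣q∣ p q))

∣p∪q∣≡∣p∣+∣q∣ : (p q : Subset N) → Empty (p ∩ q) → ∣ p ∪ q ∣ ≡ ∣ p ∣ + ∣ q ∣
∣p∪q∣≡∣p∣+∣q∣ {N} p q p∩q=∅ = begin
  ∣ p ∪ q ∣              ≡⟨ +-identityʳ ∣ p ∪ q ∣ ⟨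
  ∣ p ∪ q ∣ + 0          ≡⟨ cong (∣ p ∪ q ∣ +_) ∣p∩q∣≡0 ⟨
  ∣ p ∪ q ∣ + ∣ p ∩ q ∣  ≡⟨ ∣p∪q∣+∣p∩q∣≡∣p∣+∣q∣ p q ⟩
  ∣ p ∣ + ∣ q ∣          ∎
  where
  open ≡-Reasoning
  ∣p∩q∣≡0 : ∣ p ∩ q ∣ ≡ 0
  ∣p∩q∣≡0 = trans (cong ∣_∣ (Empty-unique p∩q=∅)) (∣⊥∣≡0 N)

∣q─p∣+∣p∣≡∣q∣ : {p q : Subset N} → p ⊆ q → ∣ q ─ p ∣ + ∣ p ∣ ≡ ∣ q ∣
∣q─p∣+∣p∣≡∣q∣ {p = p} {q} p⊆q = begin
  ∣ q ─ p ∣ + ∣ p ∣  ≡⟨ ∣p∪q∣≡∣p∣+∣q∣ (q ─ p) p (Empty-∩⁺ (x∈p─q⇒x∉q q p)) ⟨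
  ∣ (q ─ p) ∪ p ∣    ≡⟨ cong ∣_∣ (⊆-antisym (∪-⊆ (p─q⊆p q p) p⊆q) q⊆[q─p]∪p) ⟩
  ∣ q ∣              ∎
  where
  open ≡-Reasoning
  q⊆[q─p]∪p : q ⊆ (q ─ p) ∪ p
  q⊆[q─p]∪p {x} x∈q with x ∈? p
  ... | yes x∈p = q⊆p∪q (q ─ p) p x∈p
  ... | no  x∉p = p⊆p∪q p (x∈p∧x∉q⇒x∈p─q x∈q x∉p)

∣p∩q∣+∣p∩r∣≡∣p∣ : (p q r : Subset N) → Empty (q ∩ r) → p ⊆ q ∪ r →
                  ∣ p ∩ q ∣ + ∣ p ∩ r ∣ ≡ ∣ p ∣
∣p∩q∣+∣p∩r∣≡∣p∣ p q r q∩r=∅ p⊆q∪r = begin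
  ∣ p ∩ q ∣ + ∣ p ∩ r ∣  ≡⟨ ∣p∪q∣≡∣p∣+∣q∣ (p ∩ q) (p ∩ r) parts-disjoint ⟨
  ∣ p ∩ q ∪ p ∩ r ∣      ≡⟨ cong ∣_∣ (⊆-antisym (∪-⊆ (p∩q⊆p p q) (p∩q⊆p p r)) p⊆parts) ⟩
  ∣ p ∣                  ∎
  where
  open ≡-Reasoning
  parts-disjoint : Empty ((p ∩ q) ∩ (p ∩ r))
  parts-disjoint = Empty-∩⁺ λ x∈p∩q x∈p∩r → Empty-∩⁻ q∩r=∅ (p∩q⊆q p q x∈p∩q) (p∩q⊆q p r x∈p∩r)
  p⊆parts : p ⊆ p ∩ q ∪ p ∩ r
  p⊆parts x∈p with x∈p∪q⁻ q r (p⊆q∪r x∈p)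
  ... | inj₁ x∈q = p⊆p∪q (p ∩ r) (x∈p∩q⁺ (x∈p , x∈q))
  ... | inj₂ x∈r = q⊆p∪q (p ∩ q) (p ∩ r) (x∈p∩q⁺ (x∈p , x∈r))

∣p-x∣+1≡∣p∣ : {p : Subset N} {x : Fin N} → x ∈ p → ∣ p - x ∣ + 1 ≡ ∣ p ∣
∣p-x∣+1≡∣p∣ {p = p} {x} x∈p =
  trans (cong (∣ p - x ∣ +_) (sym (∣⁅x⁆∣≡1 x))) (∣q─p∣+∣p∣≡∣q∣ (⁅x⁆⊆ x∈p))

∣p∪⁅x⁆∣≡∣p∣+1 : {p : Subset N} {x : Fin N} → x ∉ p → ∣ p ∪ ⁅ x ⁆ ∣ ≡ ∣ p ∣ + 1
∣p∪⁅x⁆∣≡∣p∣+1 {p = p} {x} x∉p =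
  trans (∣p∪q∣≡∣p∣+∣q∣ p ⁅ x ⁆ (Empty-∩⁺ λ y∈p y∈⁅x⁆ → x∉p (subst (_∈ p) (x∈⁅y⁆⇒x≡y x y∈⁅x⁆) y∈p)))
        (cong (∣ p ∣ +_) (∣⁅x⁆∣≡1 x))

card-exchange : {p q : Subset N} {x y : Fin N} → x ∈ p → y ∈ q → p - x ⊆ q - y → ∣ p ∣ ≤ ∣ q ∣
card-exchange {p = p} {q} {x} {y} x∈p y∈q p-x⊆q-y = begin
  ∣ p ∣          ≡⟨ ∣p-x∣+1≡∣p∣ x∈p ⟨
  ∣ p - x ∣ + 1  ≤⟨ +-monoˡ-≤ 1 (p⊆q⇒∣p∣≤∣q∣ p-x⊆q-y) ⟩
  ∣ q - y ∣ + 1  ≡⟨ ∣p-x∣+1≡∣p∣ y∈q ⟩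
  ∣ q ∣          ∎
  where open ≤-Reasoning

∣p∣<2⇒x≡y : {p : Subset N} {x y : Fin N} → ∣ p ∣ < 2 → x ∈ p → y ∈ p → x ≡ y
∣p∣<2⇒x≡y {p = p} {x} {y} ∣p∣<2 x∈p y∈p with x ≟ᶠ y
... | yes x≡y = x≡y
... | no  x≢y = ⊥-elim (≤⇒≯ 2≤∣p∣ ∣p∣<2)
  where
  open ≤-Reasoning
  2≤∣p∣ : 2 ≤ ∣ p ∣
  2≤∣p∣ = begin
    2                  ≡⟨ cong (_+ 1) (∣⁅x⁆∣≡1 x) ⟨
    ∣ ⁅ x ⁆ ∣ + 1      ≡⟨ ∣p∪⁅x⁆∣≡∣p∣+1 (λ y∈⁅x⁆ → x≢y (sym (x∈⁅y⁆⇒x≡y x y∈⁅x⁆))) ⟨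
    ∣ ⁅ x ⁆ ∪ ⁅ y ⁆ ∣  ≤⟨ p⊆q⇒∣p∣≤∣q∣ (∪-⊆ (⁅x⁆⊆ x∈p) (⁅x⁆⊆ y∈p)) ⟩
    ∣ p ∣              ∎

enlarge : (d : ℕ) {P Q : Subset N} → P ⊆ Q → d + ∣ P ∣ ≤ ∣ Q ∣ →
          Σ[ R ∈ Subset N ] (P ⊆ R × R ⊆ Q × ∣ R ∣ ≡ d + ∣ P ∣)
enlarge zero    {P} P⊆Q _ = P , (λ x∈P → x∈P) , P⊆Q , refl
enlarge (suc d) {P} {Q} P⊆Q room with nonempty? (Q ─ P)
... | yes (x , x∈Q─P) =
  let (R , P∪⁅x⁆⊆R , R⊆Q , ∣R∣≡) = enlarge d P∪⁅x⁆⊆Q (subst (_≤ ∣ Q ∣) sizes room)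
  in R , (λ y∈P → P∪⁅x⁆⊆R (p⊆p∪q ⁅ x ⁆ y∈P)) , R⊆Q , trans ∣R∣≡ (sym sizes)
  where
  P∪⁅x⁆⊆Q : P ∪ ⁅ x ⁆ ⊆ Q
  P∪⁅x⁆⊆Q = ∪-⊆ P⊆Q (⁅x⁆⊆ (p─q⊆p Q P x∈Q─P))
  sizes : suc d + ∣ P ∣ ≡ d + ∣ P ∪ ⁅ x ⁆ ∣
  sizes = begin
    suc d + ∣ P ∣          ≡⟨ +-suc d ∣ P ∣ ⟨
    d + suc ∣ P ∣          ≡⟨ cong (d +_) (+-comm 1 ∣ P ∣) ⟩
    d + (∣ P ∣ + 1)        ≡⟨ cong (d +_) (∣p∪⁅x⁆∣≡∣p∣+1 (x∈p─q⇒x∉q Q P x∈Q─P)) ⟨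
    d + ∣ P ∪ ⁅ x ⁆ ∣      ∎
    where open ≡-Reasoning
... | no Q─P=∅ = ⊥-elim (<⇒≱ (≤-trans (s≤s (m≤n+m ∣ P ∣ d)) room) (p⊆q⇒∣p∣≤∣q∣ Q⊆P))
  where
  Q⊆P : Q ⊆ P
  Q⊆P {x} x∈Q with x ∈? P
  ... | yes x∈P = x∈P
  ... | no  x∉P = ⊥-elim (Q─P=∅ (x , x∈p∧x∉q⇒x∈p─q x∈Q x∉P))

complete : (r : ℕ) {P Q : Subset N} → P ⊆ Q → ∣ P ∣ ≤ r → r ≤ ∣ Q ∣ →
           Σ[ R ∈ Subset N ] (P ⊆ R × R ⊆ Q × ∣ R ∣ ≡ r)
complete r {P} P⊆Q ∣P∣≤r r≤∣Q∣ =
  let (R , P⊆R , R⊆Q , ∣R∣≡) = enlarge (r ∸ ∣ P ∣) P⊆Q (≤-trans (≤-reflexive (m∸n+n≡m ∣P∣≤r)) r≤∣Q∣)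
  in R , P⊆R , R⊆Q , trans ∣R∣≡ (m∸n+n≡m ∣P∣≤r)

hit : ℕ → Subset N → Subset N → ℕ
hit t M B = hits t M (B ∷ [])

hits-++ : ∀ t (M : Subset N) 𝒜 ℬ → hits t M (𝒜 ++ ℬ) ≡ hits t M 𝒜 + hits t M ℬ
hits-++ t M 𝒜 ℬ =
  trans (cong length (filter-++ (λ B → t ≤? ∣ M ∩ B ∣) 𝒜 ℬ)) (length-++ (filter _ 𝒜))

hits-∷ : ∀ t (M : Subset N) B ℬ → hits t M (B ∷ ℬ) ≡ hit t M B + hits t M ℬ
hits-∷ t M B = hits-++ t M (B ∷ [])

hit-≡1 : ∀ {t} {M B : Subset N} → t ≤ ∣ M ∩ B ∣ → hit t M B ≡ 1
hit-≡1 {t = t} {M} met = cong length (filter-accept (λ B → t ≤? ∣ M ∩ B ∣) {xs = []} met)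

hit-≡0 : ∀ {t} {M B : Subset N} → ¬ t ≤ ∣ M ∩ B ∣ → hit t M B ≡ 0
hit-≡0 {t = t} {M} ¬met = cong length (filter-reject (λ B → t ≤? ∣ M ∩ B ∣) {xs = []} ¬met)

hit-mono : ∀ t t' (M M' B B' : Subset N) →
           (t' ≤ ∣ M' ∩ B' ∣ → t ≤ ∣ M ∩ B ∣) → hit t' M' B' ≤ hit t M B
hit-mono t t' M M' B B' dominated with t' ≤? ∣ M' ∩ B' ∣
... | yes met = ≤-reflexive (trans (hit-≡1 {M = M'} {B'} met) (sym (hit-≡1 {M = M} {B} (dominated met))))
... | no ¬met = subst (_≤ hit t M B) (sym (hit-≡0 {M = M'} {B'} ¬met)) z≤n

hits-map-mono : ∀ t t' (M M' : Subset N) (f : Subset N → Subset N) (ℬ : List (Subset N)) →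
  (∀ B → t' ≤ ∣ M' ∩ B ∣ → t ≤ ∣ M ∩ f B ∣) → hits t' M' ℬ ≤ hits t M (map f ℬ)
hits-map-mono t t' M M' f [] _ = z≤n
hits-map-mono t t' M M' f (B ∷ ℬ) dominated = begin
  hits t' M' (B ∷ ℬ)                  ≡⟨ hits-∷ t' M' B ℬ ⟩
  hit t' M' B + hits t' M' ℬ          ≤⟨ +-mono-≤ (hit-mono t t' M M' (f B) B (dominated B))
                                                   (hits-map-mono t t' M M' f ℬ dominated) ⟩
  hit t M (f B) + hits t M (map f ℬ)  ≡⟨ hits-∷ t M (f B) (map f ℬ) ⟨
  hits t M (map f (B ∷ ℬ))            ∎
  where open ≤-Reasoning

hit-∈ : ∀ t (M : Subset N) {B} ℬ → B ∈ₗ ℬ → hit t M B ≤ hits t M ℬ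
hit-∈ t M (B ∷ ℬ) (here refl) = ≤-trans (m≤m+n _ _) (≤-reflexive (sym (hits-∷ t M B ℬ)))
hit-∈ t M (B ∷ ℬ) (there B∈ℬ) =
  ≤-trans (hit-∈ t M ℬ B∈ℬ) (≤-trans (m≤n+m _ _) (≤-reflexive (sym (hits-∷ t M B ℬ))))

hits-choice : ∀ {A : Set} t (M : Subset N) (f : A → List (Subset N)) (g : A → Subset N) →
  (∀ x → g x ∈ₗ f x) → (xs : List A) → hits t M (map g xs) ≤ hits t M (concatMap f xs)
hits-choice t M f g chosen [] = z≤n
hits-choice t M f g chosen (x ∷ xs) = begin
  hits t M (map g (x ∷ xs))                   ≡⟨ hits-∷ t M (g x) (map g xs) ⟩
  hit t M (g x) + hits t M (map g xs)         ≤⟨ +-mono-≤ (hit-∈ t M (f x) (chosen x))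
                                                            (hits-choice t M f g chosen xs) ⟩
  hits t M (f x) + hits t M (concatMap f xs)  ≡⟨ hits-++ t M (f x) (concatMap f xs) ⟨
  hits t M (concatMap f (x ∷ xs))             ∎
  where open ≤-Reasoning

hits-removeOne : ∀ t (M x : Subset N) ℬ → hits t M ℬ ≤ hits t M (x ∷ removeOne x ℬ)
hits-removeOne t M x [] = z≤n
hits-removeOne t M x (y ∷ ℬ) with ≡-dec _≟ᵇ_ x y
... | yes refl = ≤-refl
... | no _ = begin
  hits t M (y ∷ ℬ)                                    ≡⟨ hits-∷ t M y ℬ ⟩
  hit t M y + hits t M ℬ                              ≤⟨ +-monoʳ-≤ (hit t M y) (hits-removeOne t M x ℬ) ⟩
  hit t M y + hits t M (x ∷ removeOne x ℬ)            ≡⟨ cong (hit t M y +_) (hits-∷ t M x _) ⟩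
  hit t M y + (hit t M x + hits t M (removeOne x ℬ))  ≡⟨ x∙yz≈y∙xz (hit t M y) (hit t M x) _ ⟩
  hit t M x + (hit t M y + hits t M (removeOne x ℬ))  ≡⟨ cong (hit t M x +_) (hits-∷ t M y _) ⟨
  hit t M x + hits t M (y ∷ removeOne x ℬ)            ≡⟨ hits-∷ t M x _ ⟨
  hits t M (x ∷ y ∷ removeOne x ℬ)                    ∎
  where open ≤-Reasoning

hits-∪ₘˡ : ∀ t (M : Subset N) 𝒜 ℬ → hits t M 𝒜 ≤ hits t M (𝒜 ∪ₘ ℬ)
hits-∪ₘˡ t M 𝒜 ℬ = ≤-trans (m≤m+n _ _) (≤-reflexive (sym (hits-++ t M 𝒜 (ℬ ∖ₘ 𝒜))))

hits-∪ₘʳ : ∀ t (M : Subset N) 𝒜 ℬ → hits t M ℬ ≤ hits t M (𝒜 ∪ₘ ℬ)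
hits-∪ₘʳ t M [] ℬ = ≤-refl
hits-∪ₘʳ t M (A ∷ 𝒜) ℬ = begin
  hits t M ℬ                                 ≤⟨ hits-removeOne t M A ℬ ⟩
  hits t M (A ∷ removeOne A ℬ)               ≡⟨ hits-∷ t M A _ ⟩
  hit t M A + hits t M (removeOne A ℬ)       ≤⟨ +-monoʳ-≤ (hit t M A) (hits-∪ₘʳ t M 𝒜 (removeOne A ℬ)) ⟩
  hit t M A + hits t M (𝒜 ∪ₘ removeOne A ℬ)  ≡⟨ hits-∷ t M A _ ⟨
  hits t M (A ∷ 𝒜 ∪ₘ removeOne A ℬ)          ∎
  where open ≤-Reasoning

All-∪ₘ : {P : Subset N → Set} (𝒜 ℬ : List (Subset N)) → All P 𝒜 → All P ℬ → All P (𝒜 ∪ₘ ℬ)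
All-∪ₘ {P = P} 𝒜 ℬ all𝒜 allℬ = ++⁺ all𝒜 (All-∖ₘ 𝒜 ℬ allℬ)
  where
  All-removeOne : ∀ x ℬ → All P ℬ → All P (removeOne x ℬ)
  All-removeOne x []      []           = []
  All-removeOne x (y ∷ ℬ) (Py ∷ allℬ) with ≡-dec _≟ᵇ_ x y
  ... | yes _ = allℬ
  ... | no  _ = Py ∷ All-removeOne x ℬ allℬ
  All-∖ₘ : ∀ 𝒜 ℬ → All P ℬ → All P (ℬ ∖ₘ 𝒜)
  All-∖ₘ []      ℬ allℬ = allℬ
  All-∖ₘ (x ∷ 𝒜) ℬ allℬ = All-∖ₘ 𝒜 (removeOne x ℬ) (All-removeOne x ℬ allℬ)

∪ₘ-disjoint : (𝒜 ℬ : List (Subset N)) → All (λ A → All (A ≢_) ℬ) 𝒜 → 𝒜 ∪ₘ ℬ ≡ 𝒜 ++ ℬ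
∪ₘ-disjoint 𝒜 ℬ fresh = cong (𝒜 ++_) (∖ₘ-absent 𝒜 fresh)
  where
  removeOne-absent : ∀ x ℬ → All (x ≢_) ℬ → removeOne x ℬ ≡ ℬ
  removeOne-absent x []      []             = refl
  removeOne-absent x (y ∷ ℬ) (x≢y ∷ x∉ℬ) with ≡-dec _≟ᵇ_ x y
  ... | yes x≡y = contradiction x≡y x≢y
  ... | no  _   = cong (y ∷_) (removeOne-absent x ℬ x∉ℬ)
  ∖ₘ-absent : ∀ 𝒜 → All (λ A → All (A ≢_) ℬ) 𝒜 → ℬ ∖ₘ 𝒜 ≡ ℬ
  ∖ₘ-absent []      []            = refl
  ∖ₘ-absent (A ∷ 𝒜) (A∉ℬ ∷ fresh) rewrite removeOne-absent A ℬ A∉ℬ = ∖ₘ-absent 𝒜 fresh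

-- Arithmetic core of lifting: for P ⊆ R with p = |P|, r = |R ─ P|, |R| = m - d,
-- and q = |M ∩ T| ≥ d, a block with c points in P and at least t - d points in R
-- (so t - d ≤ c + r) gives c + q ≥ t.
lift-arith : ∀ {t d c r p q m} → d ≤ q → r + p ≡ m ∸ d → p + q ≡ m → t ∸ d ≤ c + r → t ≤ c + q
lift-arith {t} {d} {c} {r} {p} {q} {m} d≤q r+p≡m∸d p+q≡m t∸d≤c+r = begin
  t                  ≤⟨ m≤n+m∸n t d ⟩
  d + (t ∸ d)        ≤⟨ +-monoʳ-≤ d t∸d≤c+r ⟩
  d + (c + r)        ≡⟨ cong (λ z → d + (c + z)) r≡q∸d ⟩
  d + (c + (q ∸ d))  ≡⟨ x∙yz≈y∙xz d c (q ∸ d) ⟩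
  c + (d + (q ∸ d))  ≡⟨ cong (c +_) (m+[n∸m]≡n d≤q) ⟩
  c + q              ∎
  where
  open ≤-Reasoning
  r≡q∸d : r ≡ q ∸ d
  r≡q∸d = +-cancelʳ-≡ p r (q ∸ d) (begin-equality
    r + p            ≡⟨ r+p≡m∸d ⟩
    m ∸ d            ≡⟨ cong (_∸ d) p+q≡m ⟨
    p + q ∸ d        ≡⟨ +-∸-assoc p d≤q ⟩
    p + (q ∸ d)      ≡⟨ +-comm p (q ∸ d) ⟩
    q ∸ d + p        ∎)

lift-block : ∀ {t m d} (Y T M R C : Subset N) → Empty (Y ∩ T) → M ⊆ Y ∪ T → ∣ M ∣ ≡ m →
             d ≤ ∣ M ∩ T ∣ → M ∩ Y ⊆ R → ∣ R ∣ ≡ m ∸ d →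
             t ∸ d ≤ ∣ R ∩ C ∣ → t ≤ ∣ M ∩ (C ∪ T) ∣
lift-block Y T M R C Y∩T=∅ M⊆Y∪T ∣M∣≡m d≤∣M∩T∣ P⊆R ∣R∣≡m∸d met =
  ≤-trans (lift-arith d≤∣M∩T∣ (trans (∣q─p∣+∣p∣≡∣q∣ P⊆R) ∣R∣≡m∸d)
                      (trans (∣p∩q∣+∣p∩r∣≡∣p∣ M Y T Y∩T=∅ M⊆Y∪T) ∣M∣≡m)
                      (≤-trans met ∣R∩C∣≤))
          ∣P∩C∣+∣M∩T∣≤
  where
  P : Subset _
  P = M ∩ Y
  -- points of R ∩ C outside P lie in R ─ P
  ∣R∩C∣≤ : ∣ R ∩ C ∣ ≤ ∣ P ∩ C ∣ + ∣ R ─ P ∣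
  ∣R∩C∣≤ = ≤-trans (p⊆q⇒∣p∣≤∣q∣ R∩C⊆) (∣p∪q∣≤∣p∣+∣q∣ (P ∩ C) (R ─ P))
    where
    R∩C⊆ : R ∩ C ⊆ P ∩ C ∪ (R ─ P)
    R∩C⊆ {x} x∈R∩C with x ∈? P
    ... | yes x∈P = p⊆p∪q (R ─ P) (x∈p∩q⁺ (x∈P , p∩q⊆q R C x∈R∩C))
    ... | no  x∉P = q⊆p∪q (P ∩ C) (R ─ P) (x∈p∧x∉q⇒x∈p─q (p∩q⊆p R C x∈R∩C) x∉P)
  -- P ∩ C and M ∩ T are disjoint parts of M ∩ (C ∪ T)
  ∣P∩C∣+∣M∩T∣≤ : ∣ P ∩ C ∣ + ∣ M ∩ T ∣ ≤ ∣ M ∩ (C ∪ T) ∣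
  ∣P∩C∣+∣M∩T∣≤ = begin
    ∣ P ∩ C ∣ + ∣ M ∩ T ∣  ≡⟨ ∣p∪q∣≡∣p∣+∣q∣ (P ∩ C) (M ∩ T) P∩C∩M∩T=∅ ⟨
    ∣ P ∩ C ∪ M ∩ T ∣      ≤⟨ p⊆q⇒∣p∣≤∣q∣ (∪-⊆ P∩C⊆ (∩-monoʳ-⊆ M (q⊆p∪q C T))) ⟩
    ∣ M ∩ (C ∪ T) ∣        ∎
    where
    open ≤-Reasoning
    P∩C∩M∩T=∅ : Empty ((P ∩ C) ∩ (M ∩ T))
    P∩C∩M∩T=∅ = Empty-∩⁺ λ x∈P∩C x∈M∩T →
      Empty-∩⁻ Y∩T=∅ (p∩q⊆q M Y (p∩q⊆p P C x∈P∩C)) (p∩q⊆q M T x∈M∩T)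
    P∩C⊆ : P ∩ C ⊆ M ∩ (C ∪ T)
    P∩C⊆ x∈P∩C = x∈p∩q⁺ (p∩q⊆p M Y (p∩q⊆p P C x∈P∩C) , p⊆p∪q T (p∩q⊆q P C x∈P∩C))

lift-cover : ∀ {t m d lam} (Y T M : Subset N) (𝒞 : List (Subset N)) →
  Empty (Y ∩ T) → M ⊆ Y ∪ T → ∣ M ∣ ≡ m → d ≤ ∣ M ∩ T ∣ → m ∸ d ≤ ∣ Y ∣ →
  (∀ R → R ⊆ Y → ∣ R ∣ ≡ m ∸ d → lam ≤ hits (t ∸ d) R 𝒞) →
  lam ≤ hits t M (map (λ C → C ∪ T) 𝒞)
lift-cover {t = t} {m} {d} Y T M 𝒞 Y∩T=∅ M⊆Y∪T ∣M∣≡m d≤∣M∩T∣ room covers =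
  let (R , M∩Y⊆R , R⊆Y , ∣R∣≡m∸d) = complete (m ∸ d) (p∩q⊆q M Y) ∣M∩Y∣≤m∸d room
  in ≤-trans (covers R R⊆Y ∣R∣≡m∸d)
             (hits-map-mono t (t ∸ d) M R (λ C → C ∪ T) 𝒞 λ C →
                lift-block Y T M R C Y∩T=∅ M⊆Y∪T ∣M∣≡m d≤∣M∩T∣ M∩Y⊆R ∣R∣≡m∸d)
  where
  ∣M∩Y∣≤m∸d : ∣ M ∩ Y ∣ ≤ m ∸ d
  ∣M∩Y∣≤m∸d = m+n≤o⇒m≤o∸n ∣ M ∩ Y ∣ (begin
    ∣ M ∩ Y ∣ + d          ≤⟨ +-monoʳ-≤ ∣ M ∩ Y ∣ d≤∣M∩T∣ ⟩
    ∣ M ∩ Y ∣ + ∣ M ∩ T ∣  ≡⟨ ∣p∩q∣+∣p∩r∣≡∣p∣ M Y T Y∩T=∅ M⊆Y∪T ⟩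
    ∣ M ∣                  ≡⟨ ∣M∣≡m ⟩
    m                      ∎)
    where open ≤-Reasoning

replace : Subset N → Fin N → Fin N → Subset N
replace M s a = (M - s) ∪ ⁅ a ⁆

replace-miss : (M B : Subset N) (s a : Fin N) → a ∉ B → replace M s a ∩ B ⊆ M ∩ B
replace-miss M B s a a∉B {x} x∈M'∩B with x∈p∪q⁻ (M - s) ⁅ a ⁆ (p∩q⊆p (replace M s a) B x∈M'∩B)
... | inj₁ x∈M-s = x∈p∩q⁺ (p─q⊆p M ⁅ s ⁆ x∈M-s , p∩q⊆q (replace M s a) B x∈M'∩B)
... | inj₂ x∈⁅a⁆ = contradiction (subst (_∈ B) (x∈⁅y⁆⇒x≡y a x∈⁅a⁆) (p∩q⊆q (replace M s a) B x∈M'∩B)) a∉B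

replace-hit : (M B : Subset N) (s a : Fin N) → s ∈ M → a ∈ B →
              ∣ replace M s a ∩ B ∣ ≤ ∣ M ∩ ((B - a) ∪ ⁅ s ⁆) ∣
replace-hit M B s a s∈M a∈B = card-exchange
  (x∈p∩q⁺ (q⊆p∪q (M - s) ⁅ a ⁆ (x∈⁅x⁆ a) , a∈B))
  (x∈p∩q⁺ (s∈M , q⊆p∪q (B - a) ⁅ s ⁆ (x∈⁅x⁆ s)))
  shifted
  where
  M' B' : Subset _
  M' = replace M s a
  B' = (B - a) ∪ ⁅ s ⁆
  shifted : (M' ∩ B) - a ⊆ (M ∩ B') - s
  shifted {x} x∈ with x∈p∪q⁻ (M - s) ⁅ a ⁆ (p∩q⊆p M' B (p─q⊆p (M' ∩ B) ⁅ a ⁆ x∈))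
  ... | inj₂ x∈⁅a⁆ = contradiction (x∈⁅y⁆⇒x≡y a x∈⁅a⁆) (x∈p-y⇒x≢y (M' ∩ B) x∈)
  ... | inj₁ x∈M-s = x∈p∧x≢y⇒x∈p-y
    (x∈p∩q⁺ (p─q⊆p M ⁅ s ⁆ x∈M-s ,
             p⊆p∪q ⁅ s ⁆ (x∈p∧x≢y⇒x∈p-y (p∩q⊆q M' B (p─q⊆p (M' ∩ B) ⁅ a ⁆ x∈)) (x∈p-y⇒x≢y (M' ∩ B) x∈))))
    (x∈p-y⇒x≢y M x∈M-s)

swap-hits : ∀ t (M : Subset N) (a s : Fin N) → s ∈ M → (ℬ : List (Subset N)) →
  hits t (replace M s a) ℬ ≤ hits t M ℬ + hits t M (map (_∪ ⁅ s ⁆) (derived a ℬ))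
swap-hits t M a s s∈M [] = z≤n
swap-hits t M a s s∈M (B ∷ ℬ) with a ∈? B
... | yes a∈B = begin
  hits t M' (B ∷ ℬ)                            ≡⟨ hits-∷ t M' B ℬ ⟩
  hit t M' B + hits t M' ℬ                     ≤⟨ +-mono-≤ traded (swap-hits t M a s s∈M ℬ) ⟩
  hit t M B' + (hits t M ℬ + G)                ≤⟨ m≤n+m _ (hit t M B) ⟩
  hit t M B + (hit t M B' + (hits t M ℬ + G))  ≡⟨ regroup (hit t M B) (hit t M B') (hits t M ℬ) G ⟩
  (hit t M B + hits t M ℬ) + (hit t M B' + G)  ≡⟨ cong₂ _+_ (hits-∷ t M B ℬ) (hits-∷ t M B' _) ⟨
  hits t M (B ∷ ℬ) + hits t M (B' ∷ map (_∪ ⁅ s ⁆) (derived a ℬ)) ∎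
  where
  open ≤-Reasoning
  M' B' : Subset _
  M' = replace M s a
  B' = (B - a) ∪ ⁅ s ⁆
  G : ℕ
  G = hits t M (map (_∪ ⁅ s ⁆) (derived a ℬ))
  traded : hit t M' B ≤ hit t M B'
  traded = hit-mono t t M M' B' B λ met → ≤-trans met (replace-hit M B s a s∈M a∈B)
  regroup : ∀ w x y z → w + (x + (y + z)) ≡ (w + y) + (x + z)
  regroup w x y z = trans (cong (w +_) (x∙yz≈y∙xz x y z)) (sym (+-assoc w y (x + z)))
... | no a∉B = begin
  hits t M' (B ∷ ℬ)              ≡⟨ hits-∷ t M' B ℬ ⟩
  hit t M' B + hits t M' ℬ       ≤⟨ +-mono-≤ kept (swap-hits t M a s s∈M ℬ) ⟩
  hit t M B + (hits t M ℬ + G)   ≡⟨ +-assoc (hit t M B) (hits t M ℬ) G ⟨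
  (hit t M B + hits t M ℬ) + G   ≡⟨ cong (_+ G) (hits-∷ t M B ℬ) ⟨
  hits t M (B ∷ ℬ) + G           ∎
  where
  open ≤-Reasoning
  M' : Subset _
  M' = replace M s a
  G : ℕ
  G = hits t M (map (_∪ ⁅ s ⁆) (derived a ℬ))
  kept : hit t M' B ≤ hit t M B
  kept = hit-mono t t M M' B B λ met → ≤-trans met (p⊆q⇒∣p∣≤∣q∣ (replace-miss M B s a a∉B))

KSubset : Subset N → ℕ → Subset N → Set
KSubset Y k B = B ⊆ Y × ∣ B ∣ ≡ k

Covers : ℕ → ℕ → ℕ → Subset N → List (Subset N) → Set
Covers {N = N} t m lam Y ℬ = ∀ (M : Subset N) → M ⊆ Y → ∣ M ∣ ≡ m → lam ≤ hits t M ℬ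

All-blocks₂ : {P Q : Subset N → Set} (S : Subset N) (a : Fin N) →
  (∀ {B s} → P B → a ∈ B → s ∈ S → Q ((B - a) ∪ ⁅ s ⁆)) →
  (ℬ : List (Subset N)) → All P ℬ → All Q (blocks₂ S a ℬ)
All-blocks₂ S a form [] [] = []
All-blocks₂ {N = N} S a form (B ∷ ℬ) (PB ∷ allℬ) with a ∈? B
... | yes a∈B = ++⁺ (map⁺ (All.map (form PB a∈B) (all-filter (_∈? S) (allFin N))))
                    (All-blocks₂ S a form ℬ allℬ)
... | no  _   = All-blocks₂ S a form ℬ allℬ

module _ {N : ℕ} {X S : Subset N} {a : Fin N} (X∩S=∅ : Empty (X ∩ S)) (a∈X : a ∈ X) where

  T : Subset N
  T = S ∪ ⁅ a ⁆

  a∉S : a ∉ S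
  a∉S = Empty-∩⁻ X∩S=∅ a∈X

  X-a∩T=∅ : Empty ((X - a) ∩ T)
  X-a∩T=∅ = Empty-∩⁺ λ {x} x∈X-a x∈T →
    [ Empty-∩⁻ X∩S=∅ (p─q⊆p X ⁅ a ⁆ x∈X-a) , (λ x∈⁅a⁆ → x∈p-y⇒x≢y X x∈X-a (x∈⁅y⁆⇒x≡y a x∈⁅a⁆)) ]′
      (x∈p∪q⁻ S ⁅ a ⁆ x∈T)

  X∪S⊆[X-a]∪T : X ∪ S ⊆ (X - a) ∪ T
  X∪S⊆[X-a]∪T {x} x∈X∪S with x ≟ᶠ a | x∈p∪q⁻ X S x∈X∪S
  ... | yes refl | _        = q⊆p∪q (X - a) T (q⊆p∪q S ⁅ a ⁆ (x∈⁅x⁆ a))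
  ... | no  x≢a  | inj₁ x∈X = p⊆p∪q T (x∈p∧x≢y⇒x∈p-y x∈X x≢a)
  ... | no  _    | inj₂ x∈S = q⊆p∪q (X - a) T (p⊆p∪q ⁅ a ⁆ x∈S)

  blocks₁-valid : ∀ {k} (ℬ : List (Subset N)) → All (KSubset X k) ℬ → All (KSubset (X ∪ S) k) ℬ
  blocks₁-valid ℬ = All.map λ (B⊆X , ∣B∣≡k) → (λ x∈B → p⊆p∪q S (B⊆X x∈B)) , ∣B∣≡k

  blocks₂-valid : ∀ {k} (ℬ : List (Subset N)) → All (KSubset X k) ℬ →
                  All (KSubset (X ∪ S) k) (blocks₂ S a ℬ)
  blocks₂-valid {k} = All-blocks₂ S a valid
    where
    valid : ∀ {B s} → KSubset X k B → a ∈ B → s ∈ S → KSubset (X ∪ S) k ((B - a) ∪ ⁅ s ⁆)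
    valid {B} {s} (B⊆X , ∣B∣≡k) a∈B s∈S =
      ∪-⊆ (λ x∈B-a → p⊆p∪q S (B⊆X (p─q⊆p B ⁅ a ⁆ x∈B-a))) (⁅x⁆⊆ (q⊆p∪q X S s∈S)) , (begin
        ∣ (B - a) ∪ ⁅ s ⁆ ∣  ≡⟨ ∣p∪⁅x⁆∣≡∣p∣+1 s∉B-a ⟩
        ∣ B - a ∣ + 1        ≡⟨ ∣p-x∣+1≡∣p∣ a∈B ⟩
        ∣ B ∣                ≡⟨ ∣B∣≡k ⟩
        k                    ∎)
      where
      open ≡-Reasoning
      s∉B-a : s ∉ B - a
      s∉B-a s∈B-a = Empty-∩⁻ X∩S=∅ (B⊆X (p─q⊆p B ⁅ a ⁆ s∈B-a)) s∈S

  blocks₃-valid : ∀ {k n} (𝒞 : List (Subset N)) → n + 1 ≤ k → ∣ S ∣ ≡ n →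
                  All (KSubset (X - a) (k ∸ n ∸ 1)) 𝒞 → All (KSubset (X ∪ S) k) (blocks₃ S a 𝒞)
  blocks₃-valid {k} {n} 𝒞 n+1≤k ∣S∣≡n = map⁺ ∘ All.map valid
    where
    valid : ∀ {C} → KSubset (X - a) (k ∸ n ∸ 1) C → KSubset (X ∪ S) k (C ∪ T)
    valid {C} (C⊆X-a , ∣C∣≡k∸n∸1) =
      ∪-⊆ (λ x∈C → p⊆p∪q S (p─q⊆p X ⁅ a ⁆ (C⊆X-a x∈C))) (∪-⊆ (q⊆p∪q X S) (⁅x⁆⊆ (p⊆p∪q S a∈X))) , (begin
        ∣ C ∪ T ∣              ≡⟨ ∣p∪q∣≡∣p∣+∣q∣ C T (Empty-∩⁺ λ x∈C → Empty-∩⁻ X-a∩T=∅ (C⊆X-a x∈C)) ⟩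
        ∣ C ∣ + ∣ T ∣          ≡⟨ cong₂ _+_ ∣C∣≡k∸n∸1 (trans (∣p∪⁅x⁆∣≡∣p∣+1 a∉S) (cong (_+ 1) ∣S∣≡n)) ⟩
        k ∸ n ∸ 1 + (n + 1)    ≡⟨ cong (_+ (n + 1)) (∸-+-assoc k n 1) ⟩
        k ∸ (n + 1) + (n + 1)  ≡⟨ m∸n+n≡m n+1≤k ⟩
        k                      ∎)
      where open ≡-Reasoning

  -- ℬ and ℬ₂ share no block, since blocks of ℬ₂ contain points of S.
  ℬ∪ₘℬ₂≡ℬ++ℬ₂ : ∀ {k} (ℬ : List (Subset N)) → All (KSubset X k) ℬ →
                ℬ ∪ₘ blocks₂ S a ℬ ≡ ℬ ++ blocks₂ S a ℬ
  ℬ∪ₘℬ₂≡ℬ++ℬ₂ ℬ ℬ-blocks =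
    ∪ₘ-disjoint ℬ (blocks₂ S a ℬ) (All.map (λ B-block → All.map (distinct B-block) ℬ₂-meets-S) ℬ-blocks)
    where
    ℬ₂-meets-S : All (λ B' → Nonempty (B' ∩ S)) (blocks₂ S a ℬ)
    ℬ₂-meets-S = All-blocks₂ S a (λ {B} {s} _ _ s∈S → s , x∈p∩q⁺ (q⊆p∪q (B - a) ⁅ s ⁆ (x∈⁅x⁆ s) , s∈S))
                             ℬ ℬ-blocks
    distinct : ∀ {k B B'} → KSubset X k B → Nonempty (B' ∩ S) → B ≢ B'
    distinct (B⊆X , _) (s , s∈B∩S) refl = Empty-∩⁻ X∩S=∅ (B⊆X (p∩q⊆p _ S s∈B∩S)) (p∩q⊆q _ S s∈B∩S)

  cover-swap : ∀ {k t m lam} (ℬ : List (Subset N)) {M : Subset N} {s : Fin N} →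
    All (KSubset X k) ℬ → Covers t m lam X ℬ →
    M ⊆ X ∪ S → ∣ M ∣ ≡ m → s ∈ M → s ∈ S → (∀ {x} → x ∈ M ∩ T → x ≡ s) →
    lam ≤ hits t M (ℬ ∪ₘ blocks₂ S a ℬ)
  cover-swap {t = t} {m} {lam} ℬ {M} {s} ℬ-blocks ℬ-covers M⊆X∪S ∣M∣≡m s∈M s∈S only-s = begin
    lam                                   ≤⟨ ℬ-covers (replace M s a) M'⊆X ∣M'∣≡m ⟩
    hits t (replace M s a) ℬ              ≤⟨ swap-hits t M a s s∈M ℬ ⟩
    hits t M ℬ + hits t M (map (_∪ ⁅ s ⁆) (derived a ℬ))
                                          ≤⟨ +-monoʳ-≤ (hits t M ℬ) one-trade-each ⟩
    hits t M ℬ + hits t M (blocks₂ S a ℬ) ≡⟨ hits-++ t M ℬ (blocks₂ S a ℬ) ⟨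
    hits t M (ℬ ++ blocks₂ S a ℬ)         ≡⟨ cong (hits t M) (ℬ∪ₘℬ₂≡ℬ++ℬ₂ ℬ ℬ-blocks) ⟨
    hits t M (ℬ ∪ₘ blocks₂ S a ℬ)         ∎
    where
    open ≤-Reasoning
    -- each derived block B ∈ ℬ(a) yields B ∪ {s} among its trades B ∪ {s'}, s' ∈ S
    one-trade-each : hits t M (map (_∪ ⁅ s ⁆) (derived a ℬ)) ≤ hits t M (blocks₂ S a ℬ)
    one-trade-each = hits-choice t M (λ B → map (λ s' → B ∪ ⁅ s' ⁆) (elems S)) (_∪ ⁅ s ⁆)
      (λ B → ∈-map⁺ (λ s' → B ∪ ⁅ s' ⁆) (∈-filter⁺ (_∈? S) (∈-allFin s) s∈S)) (derived a ℬ)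
    a∉M : a ∉ M
    a∉M a∈M = a∉S (subst (_∈ S) (sym (only-s (x∈p∩q⁺ (a∈M , q⊆p∪q S ⁅ a ⁆ (x∈⁅x⁆ a))))) s∈S)
    -- apart from s, M has no points of S
    M-s⊆X : M - s ⊆ X
    M-s⊆X = ⊆-∪-avoid (λ x∈M-s → M⊆X∪S (p─q⊆p M ⁅ s ⁆ x∈M-s)) (Empty-∩⁺ λ x∈M-s x∈S →
      x∈p-y⇒x≢y M x∈M-s (only-s (x∈p∩q⁺ (p─q⊆p M ⁅ s ⁆ x∈M-s , p⊆p∪q ⁅ a ⁆ x∈S))))
    M'⊆X : replace M s a ⊆ X
    M'⊆X = ∪-⊆ M-s⊆X (⁅x⁆⊆ a∈X)
    ∣M'∣≡m : ∣ replace M s a ∣ ≡ m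
    ∣M'∣≡m = trans (∣p∪⁅x⁆∣≡∣p∣+1 (λ a∈M-s → a∉M (p─q⊆p M ⁅ s ⁆ a∈M-s)))
                   (trans (∣p-x∣+1≡∣p∣ s∈M) ∣M∣≡m)

  covering : ∀ {k t m lam} (ℬ 𝒞 : List (Subset N)) → All (KSubset X k) ℬ →
    Covers t m lam X ℬ → Covers (t ∸ 2) (m ∸ 2) lam (X - a) 𝒞 → m ∸ 2 ≤ ∣ X - a ∣ →
    Covers t m lam (X ∪ S) (ℬ ∪ₘ blocks₂ S a ℬ ∪ₘ blocks₃ S a 𝒞)
  covering {t = t} ℬ 𝒞 ℬ-blocks ℬ-covers 𝒞-covers room M M⊆X∪S ∣M∣≡m with nonempty? (M ∩ S)
  ... | no M∩S=∅ =
    ≤-trans (ℬ-covers M (⊆-∪-avoid M⊆X∪S M∩S=∅) ∣M∣≡m)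
            (≤-trans (hits-∪ₘˡ t M ℬ (blocks₂ S a ℬ))
                     (hits-∪ₘˡ t M (ℬ ∪ₘ blocks₂ S a ℬ) (blocks₃ S a 𝒞)))
  ... | yes (s , s∈M∩S) with 2 ≤? ∣ M ∩ T ∣
  ...   | yes 2≤∣M∩T∣ =
    ≤-trans (lift-cover (X - a) T M 𝒞 X-a∩T=∅ (λ x∈M → X∪S⊆[X-a]∪T (M⊆X∪S x∈M))
                        ∣M∣≡m 2≤∣M∩T∣ room 𝒞-covers)
            (hits-∪ₘʳ t M (ℬ ∪ₘ blocks₂ S a ℬ) (blocks₃ S a 𝒞))
  ...   | no  2≰∣M∩T∣ =
    ≤-trans (cover-swap ℬ ℬ-blocks ℬ-covers M⊆X∪S ∣M∣≡m s∈M s∈S only-s)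
            (hits-∪ₘˡ t M (ℬ ∪ₘ blocks₂ S a ℬ) (blocks₃ S a 𝒞))
    where
    s∈M : s ∈ M
    s∈M = p∩q⊆p M S s∈M∩S
    s∈S : s ∈ S
    s∈S = p∩q⊆q M S s∈M∩S
    only-s : ∀ {x} → x ∈ M ∩ T → x ≡ s
    only-s x∈M∩T = ∣p∣<2⇒x≡y (≰⇒> 2≰∣M∩T∣) x∈M∩T (x∈p∩q⁺ (s∈M , p⊆p∪q ⁅ a ⁆ s∈S))

n+1≤k : ∀ {n k t} → 2 ≤ t → t ≤ k → n ≤ k ∸ t + 1 → n + 1 ≤ k
n+1≤k {n} {k} {t} 2≤t t≤k n≤k∸t+1 = begin
  n + 1          ≤⟨ +-monoˡ-≤ 1 n≤k∸t+1 ⟩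
  k ∸ t + 1 + 1  ≡⟨ +-assoc (k ∸ t) 1 1 ⟩
  k ∸ t + 2      ≤⟨ +-monoʳ-≤ (k ∸ t) 2≤t ⟩
  k ∸ t + t      ≡⟨ m∸n+n≡m t≤k ⟩
  k              ∎
  where open ≤-Reasoning

theorem11 : ∀ {N : ℕ} (v k m lam t n : ℕ) (X S : Subset N)
    (ℬ 𝒞 : List (Subset N)) (a : Fin N) →
    1 ≤ v → 1 ≤ k → 1 ≤ m → 1 ≤ lam → 1 ≤ n → 2 < t → n ≤ k ∸ t + 1 →
    IsGCD X v k m lam t ℬ →
    ∣ S ∣ ≡ n → Empty (X ∩ S) →
    a ∈ X → (∀ (x : Fin N) → x ∈ X → length (derived a ℬ) ≤ length (derived x ℬ)) →
    IsGCD (X - a) (v ∸ 1) (k ∸ n ∸ 1) (m ∸ 2) lam (t ∸ 2) 𝒞 →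
    IsGCD (X ∪ S) (v + n) k m lam t (ℬ ∪ₘ blocks₂ S a ℬ ∪ₘ blocks₃ S a 𝒞)
theorem11 v k m lam t n X S ℬ 𝒞 a _ _ _ _ _ 2<t n≤k∸t+1
  (∣X∣≡v , 1≤t , t≤k , k≤v , t≤m , m≤v , 1≤lam , ℬ-blocks , ℬ-covers) ∣S∣≡n X∩S=∅ a∈X _
  (∣X-a∣≡v∸1 , _ , _ , _ , _ , _ , _ , 𝒞-blocks , 𝒞-covers) =
  trans (∣p∪q∣≡∣p∣+∣q∣ X S X∩S=∅) (cong₂ _+_ ∣X∣≡v ∣S∣≡n) ,
  1≤t , t≤k , ≤-trans k≤v (m≤m+n v n) , t≤m , ≤-trans m≤v (m≤m+n v n) , 1≤lam ,
  All-∪ₘ _ _ (All-∪ₘ _ _ (blocks₁-valid X∩S=∅ a∈X ℬ ℬ-blocks) (blocks₂-valid X∩S=∅ a∈X ℬ ℬ-blocks))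
             (blocks₃-valid X∩S=∅ a∈X 𝒞 (n+1≤k (<⇒≤ 2<t) t≤k n≤k∸t+1) ∣S∣≡n 𝒞-blocks) ,
  covering X∩S=∅ a∈X ℬ 𝒞 ℬ-blocks ℬ-covers 𝒞-covers
    (≤-trans (∸-mono m≤v (s≤s z≤n)) (≤-reflexive (sym ∣X-a∣≡v∸1)))
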